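{- For all $n\in\mathbb{N}^+$ and $b,b'\in\{0,1\}$, $E^{bb'}_n(1/2,\ldots,1/2)=\dfrac{f_{n+b+b'}}{2^n}$.
   Context: $(f_n)$ is the Fibonacci sequence ($f_0=0$, $f_1=1$, $f_n=f_{n-1}+f_{n-2}$). For $n\in\mathbb{N}^+$, $P_n$ is the path with vertices $v_0,\ldots,v_n$ and edges $\{v_j,v_{j+1}\}$, $0\leq j\leq n-1$. For $\rho\in[0,1]^n$, consider the random edge subset $E'$ of $P_n$ where edge $\{v_j,v_{j+1}\}$ is kept independently with probability $\rho_j$. For $b,b'\in\{0,1\}$, $E^{bb'}_n(\rho)$ denotes the probability that every vertex of $P_n$ is incident to an edge of $E'$, except that $v_0$ is exempt from this requirement if $b=1$ and $v_n$ is exempt if $b'=1$ (equivalently, an always-present edge is attached at the left end if $b=1$ and at the right end if $b'=1$, and we ask for an edge cover of $P_n$'s vertices). Here $(1/2,\ldots,1/2)$ has length $n$. -}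

module Defs where

open import Data.Nat using (ℕ; zero; suc; _∸_; _<ᵇ_; _≡ᵇ_)
open import Data.Bool using (Bool; true; false; _∧_; _∨_; if_then_else_)
open import Data.Fin using (Fin)
open import Data.List using (List; []; _∷_; map; _++_; upTo; foldr)
open import Data.Vec using (Vec; []; _∷_; lookup; replicate)
open import Data.Rational using (ℚ; 0ℚ; 1ℚ; _+_; _*_; _-_; ½)

fib : ℕ → ℕ
fib zero = 0
fib (suc zero) = 1
fib (suc (suc n)) = fib (suc n) Data.Nat.+ fib n

-- an edge subset E' of P_n: entry j says whether edge {v_j, v_{j+1}} is kept
EdgeSet : ℕ → Set
EdgeSet n = Vec Bool n

allEdgeSets : (n : ℕ) → List (EdgeSet n)
allEdgeSets zero = [] ∷ []
allEdgeSets (suc n) = map (true ∷_) (allEdgeSets n) ++ map (false ∷_) (allEdgeSets n)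

kept : {n : ℕ} → EdgeSet n → ℕ → Bool
kept [] j = false
kept (x ∷ E) zero = x
kept (x ∷ E) (suc j) = kept E j

-- vertex v_i is incident to a kept edge: edge {v_{i-1},v_i} (i ≥ 1) or edge {v_i,v_{i+1}} (i < n)
incident : {n : ℕ} → EdgeSet n → ℕ → Bool
incident E zero = kept E zero
incident E (suc i) = kept E i ∨ kept E (suc i)

-- exemption flags: b = 1 exempts v_0, b' = 1 exempts v_n
isOne : Fin 2 → Bool
isOne Fin.zero = false
isOne (Fin.suc _) = true

-- the event of E^{bb'}_n: every vertex v_0..v_n is incident to a kept edge,
-- except v_0 if b = 1 and v_n if b' = 1
coverOK : (b b' : Fin 2) (n : ℕ) → EdgeSet n → Bool
coverOK b b' n E = foldr _∧_ true (map ok (upTo (suc n)))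
  where
  ok : ℕ → Bool
  ok i = ((i ≡ᵇ 0) ∧ isOne b) ∨ ((i ≡ᵇ n) ∧ isOne b') ∨ incident E i

-- probability of the edge subset E when edge j is kept independently with prob ρ_j
weight : {n : ℕ} → Vec ℚ n → EdgeSet n → ℚ
weight [] [] = 1ℚ
weight (r ∷ ρ) (true ∷ E) = r * weight ρ E
weight (r ∷ ρ) (false ∷ E) = (1ℚ - r) * weight ρ E

Ebb : (b b' : Fin 2) (n : ℕ) → Vec ℚ n → ℚ
Ebb b b' n ρ = foldr _+_ 0ℚ
  (map (λ E → if coverOK b b' n E then weight ρ E else 0ℚ) (allEdgeSets n))

-- Reading an edge set from left to right, the only information that has to be
-- carried along is whether the current vertex is already covered (by the
-- previous edge, or by the exemption of v₀). Writing N(l, r, n) for the number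
-- of covering edge sets of Pₙ with left state l and right exemption r, this gives
-- N(l, r, n+1) = N(true, r, n) + [l] N(false, r, n), so n ↦ N(false, r, n) obeys
-- the Fibonacci recurrence, starting at fib 0 or fib 1 according to r. Since all
-- 2ⁿ edge sets have probability 2⁻ⁿ, E = N / 2ⁿ.

module Submission where

open import Defs
open import Data.Nat using (ℕ; suc; _^_)
open import Data.Nat.Properties using (m^n≢0)
open import Data.Fin using (Fin; toℕ)
open import Data.Vec using (replicate)
open import Data.Integer using (+_)
open import Data.Rational using (ℚ; _/_; ½)
open import Relation.Binary.PropositionalEquality using (_≡_)

open import Algebra.Bundles using (CommutativeMonoid)
open import Data.Bool using (Bool; true; false; _∧_; _∨_; if_then_else_)
open import Data.Bool.ListAction using (and)
open import Data.Bool.Properties using (∨-commutativeMonoid)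
open import Data.Fin using (zero; suc)
import Data.Integer as ℤ
open import Data.Integer.Tactic.RingSolver using (solve-∀)
open import Data.List using (List; []; _∷_; map; _++_; foldr; applyUpTo)
open import Data.List.Properties using (map-upTo; map-cong)
open import Data.Nat using (zero; _+_; _≡ᵇ_; NonZero)
import Data.Nat as ℕ
open import Data.Nat.Properties using (+-identityʳ; +-comm; m*n≢0)
open import Data.Rational using (0ℚ; _*_; toℚᵘ)
import Data.Rational as ℚ
open import Data.Rational.Properties
  using (+-identityˡ; 0/n≡0; toℚᵘ-injective; toℚᵘ-fromℚᵘ; toℚᵘ-homo-+; toℚᵘ-homo-*)
open import Data.Rational.Unnormalised using (mkℚᵘ; *≡*)
import Data.Rational.Unnormalised as ℚᵘ
import Data.Rational.Unnormalised.Properties as ℚᵘ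
open import Data.Vec using (_∷_; [])
open import Function using (_∘_)
open import Relation.Binary.PropositionalEquality
  using (refl; sym; trans; cong; cong₂; module ≡-Reasoning)

open import Algebra.Properties.CommutativeSemigroup
  (CommutativeMonoid.commutativeSemigroup ∨-commutativeMonoid) using (x∙yz≈y∙xz)

-- l: the leftmost vertex is already covered; r: the rightmost vertex is exempt.
covered : Bool → Bool → {n : ℕ} → EdgeSet n → Bool
covered l r [] = l ∨ r
covered l r (x ∷ E) = (l ∨ x) ∧ covered x r E

vertexCovered : Bool → Bool → (n : ℕ) → EdgeSet n → ℕ → Bool
vertexCovered l r n E i = ((i ≡ᵇ 0) ∧ l) ∨ ((i ≡ᵇ n) ∧ r) ∨ incident E i

applyUpTo-cong : {A : Set} {f g : ℕ → A} → (∀ i → f i ≡ g i) →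
  ∀ n → applyUpTo f n ≡ applyUpTo g n
applyUpTo-cong f≗g zero = refl
applyUpTo-cong f≗g (suc n) = cong₂ _∷_ (f≗g 0) (applyUpTo-cong (f≗g ∘ suc) n)

all-vertexCovered≡covered : ∀ l r n (E : EdgeSet n) →
  and (applyUpTo (vertexCovered l r n E) (suc n)) ≡ covered l r E
all-vertexCovered≡covered true r zero [] = refl
all-vertexCovered≡covered false true zero [] = refl
all-vertexCovered≡covered false false zero [] = refl
all-vertexCovered≡covered l r (suc n) (x ∷ E) =
  cong ((l ∨ x) ∧_)
    (trans (cong and (applyUpTo-cong shift (suc n))) (all-vertexCovered≡covered x r n E))
  where
  shift : ∀ i → vertexCovered l r (suc n) (x ∷ E) (suc i) ≡ vertexCovered x r n E i
  shift zero = x∙yz≈y∙xz ((0 ≡ᵇ n) ∧ r) x (kept E 0)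
  shift (suc i) = refl

coverOK≡covered : ∀ b b' n (E : EdgeSet n) →
  coverOK b b' n E ≡ covered (isOne b) (isOne b') E
coverOK≡covered b b' n E =
  trans (cong and (map-upTo (vertexCovered (isOne b) (isOne b') n E) (suc n)))
        (all-vertexCovered≡covered (isOne b) (isOne b') n E)

count : {A : Set} → (A → Bool) → List A → ℕ
count P [] = 0
count P (x ∷ xs) = if P x then suc (count P xs) else count P xs

count-++ : {A : Set} (P : A → Bool) (xs ys : List A) →
  count P (xs ++ ys) ≡ count P xs + count P ys
count-++ P [] ys = refl
count-++ P (x ∷ xs) ys with P x
... | true = cong suc (count-++ P xs ys)
... | false = count-++ P xs ys

count-map : {A B : Set} (P : B → Bool) (f : A → B) (xs : List A) →
  count P (map f xs) ≡ count (P ∘ f) xs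
count-map P f [] = refl
count-map P f (x ∷ xs) with P (f x)
... | true = cong suc (count-map P f xs)
... | false = count-map P f xs

count-const-false : {A : Set} (xs : List A) → count (λ _ → false) xs ≡ 0
count-const-false [] = refl
count-const-false (x ∷ xs) = count-const-false xs

count-allEdgeSets-suc : ∀ n (P : EdgeSet (suc n) → Bool) →
  count P (allEdgeSets (suc n))
    ≡ count (P ∘ (true ∷_)) (allEdgeSets n) + count (P ∘ (false ∷_)) (allEdgeSets n)
count-allEdgeSets-suc n P =
  trans (count-++ P (map (true ∷_) A) (map (false ∷_) A))
        (cong₂ _+_ (count-map P (true ∷_) A) (count-map P (false ∷_) A))
  where A = allEdgeSets n

coverCount : Bool → Bool → ℕ → ℕ
coverCount l r n = count (covered l r) (allEdgeSets n)

coverCount-true-suc : ∀ r n →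
  coverCount true r (suc n) ≡ coverCount true r n + coverCount false r n
coverCount-true-suc r n = count-allEdgeSets-suc n (covered true r)

coverCount-false-suc : ∀ r n → coverCount false r (suc n) ≡ coverCount true r n
coverCount-false-suc r n = begin
  coverCount false r (suc n)                                ≡⟨ count-allEdgeSets-suc n (covered false r) ⟩
  coverCount true r n + count (λ _ → false) (allEdgeSets n) ≡⟨ cong (_+_ (coverCount true r n)) (count-const-false (allEdgeSets n)) ⟩
  coverCount true r n + 0                                   ≡⟨ +-identityʳ _ ⟩
  coverCount true r n                                       ∎
  where open ≡-Reasoning

fibonacci-like⇒fib : (a : ℕ → ℕ) (k : ℕ) → a 0 ≡ fib k → a 1 ≡ fib (suc k) →
  (∀ n → a (suc (suc n)) ≡ a (suc n) + a n) → ∀ n → a n ≡ fib (n + k)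
fibonacci-like⇒fib a k a₀ a₁ rec zero = a₀
fibonacci-like⇒fib a k a₀ a₁ rec (suc zero) = a₁
fibonacci-like⇒fib a k a₀ a₁ rec (suc (suc n)) =
  trans (rec n) (cong₂ _+_ (fibonacci-like⇒fib a k a₀ a₁ rec (suc n))
                           (fibonacci-like⇒fib a k a₀ a₁ rec n))

coverCount-false≡fib : ∀ (b' : Fin 2) n → coverCount false (isOne b') n ≡ fib (n + toℕ b')
coverCount-false≡fib b' =
  fibonacci-like⇒fib (coverCount false r) (toℕ b') (initial₀ b') (initial₁ b') recurrence
  where
  r = isOne b'
  initial₀ : ∀ b' → coverCount false (isOne b') 0 ≡ fib (toℕ b')
  initial₀ zero = refl
  initial₀ (suc zero) = refl
  initial₁ : ∀ b' → coverCount false (isOne b') 1 ≡ fib (suc (toℕ b'))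
  initial₁ zero = refl
  initial₁ (suc zero) = refl
  recurrence : ∀ n →
    coverCount false r (suc (suc n)) ≡ coverCount false r (suc n) + coverCount false r n
  recurrence n = begin
    coverCount false r (suc (suc n))               ≡⟨ coverCount-false-suc r (suc n) ⟩
    coverCount true r (suc n)                      ≡⟨ coverCount-true-suc r n ⟩
    coverCount true r n + coverCount false r n     ≡⟨ cong (_+ coverCount false r n) (coverCount-false-suc r n) ⟨
    coverCount false r (suc n) + coverCount false r n ∎
    where open ≡-Reasoning

coverCount≡fib : ∀ (b b' : Fin 2) n →
  coverCount (isOne b) (isOne b') n ≡ fib (n + toℕ b + toℕ b')
coverCount≡fib zero b' n =
  trans (coverCount-false≡fib b' n) (cong (λ i → fib (i + toℕ b')) (sym (+-identityʳ n)))
coverCount≡fib (suc zero) b' n =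
  trans (sym (coverCount-false-suc (isOne b') n))
    (trans (coverCount-false≡fib b' (suc n)) (cong (λ i → fib (i + toℕ b')) (+-comm 1 n)))

toℚᵘ-/ : ∀ i d .{{_ : NonZero d}} → toℚᵘ (i / d) ℚᵘ.≃ (i ℚᵘ./ d)
toℚᵘ-/ i (suc d) = toℚᵘ-fromℚᵘ (mkℚᵘ i d)

i/d+j/d≡[i+j]/d : ∀ i j d .{{_ : NonZero d}} → i / d ℚ.+ j / d ≡ (i ℤ.+ j) / d
i/d+j/d≡[i+j]/d i j d@(suc _) = toℚᵘ-injective (begin
  toℚᵘ (i / d ℚ.+ j / d)           ≈⟨ toℚᵘ-homo-+ (i / d) (j / d) ⟩
  toℚᵘ (i / d) ℚᵘ.+ toℚᵘ (j / d)   ≈⟨ ℚᵘ.+-cong (toℚᵘ-/ i d) (toℚᵘ-/ j d) ⟩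
  (i ℚᵘ./ d) ℚᵘ.+ (j ℚᵘ./ d)       ≈⟨ *≡* (cross-multiplied i j (+ d)) ⟩
  (i ℤ.+ j) ℚᵘ./ d                 ≈⟨ ℚᵘ.≃-sym (toℚᵘ-/ (i ℤ.+ j) d) ⟩
  toℚᵘ ((i ℤ.+ j) / d)             ∎)
  where
  open ℚᵘ.≃-Reasoning
  cross-multiplied : ∀ i j D → (i ℤ.* D ℤ.+ j ℤ.* D) ℤ.* D ≡ (i ℤ.+ j) ℤ.* (D ℤ.* D)
  cross-multiplied = solve-∀

i/c*j/d≡[i*j]/[c*d] : ∀ i j c d .{{_ : NonZero c}} .{{_ : NonZero d}} →
  (i / c) * (j / d) ≡ _/_ (i ℤ.* j) (c ℕ.* d) {{m*n≢0 c d}}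
i/c*j/d≡[i*j]/[c*d] i j c@(suc _) d@(suc _) = toℚᵘ-injective (begin
  toℚᵘ ((i / c) * (j / d))         ≈⟨ toℚᵘ-homo-* (i / c) (j / d) ⟩
  toℚᵘ (i / c) ℚᵘ.* toℚᵘ (j / d)   ≈⟨ ℚᵘ.*-cong (toℚᵘ-/ i c) (toℚᵘ-/ j d) ⟩
  (i ℤ.* j) ℚᵘ./ (c ℕ.* d)         ≈⟨ ℚᵘ.≃-sym (toℚᵘ-/ (i ℤ.* j) (c ℕ.* d)) ⟩
  toℚᵘ ((i ℤ.* j) / (c ℕ.* d))     ∎)
  where open ℚᵘ.≃-Reasoning

½*1/2ⁿ≡1/2ⁿ⁺¹ : ∀ n →
  ½ * _/_ (+ 1) (2 ^ n) {{m^n≢0 2 n}} ≡ _/_ (+ 1) (2 ^ suc n) {{m^n≢0 2 (suc n)}}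
½*1/2ⁿ≡1/2ⁿ⁺¹ n = i/c*j/d≡[i*j]/[c*d] (+ 1) (+ 1) 2 (2 ^ n) {{_}} {{m^n≢0 2 n}}

weight-replicate-½ : ∀ n (E : EdgeSet n) →
  weight (replicate n ½) E ≡ _/_ (+ 1) (2 ^ n) {{m^n≢0 2 n}}
weight-replicate-½ zero [] = refl
weight-replicate-½ (suc n) (true ∷ E) =
  trans (cong (½ *_) (weight-replicate-½ n E)) (½*1/2ⁿ≡1/2ⁿ⁺¹ n)
-- 1ℚ - ½ normalises to ½, so a discarded edge also contributes the factor ½.
weight-replicate-½ (suc n) (false ∷ E) =
  trans (cong (½ *_) (weight-replicate-½ n E)) (½*1/2ⁿ≡1/2ⁿ⁺¹ n)

sum-indicator≡count/d : {A : Set} (P : A → Bool) (d : ℕ) .{{_ : NonZero d}} (xs : List A) →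
  foldr ℚ._+_ 0ℚ (map (λ x → if P x then + 1 / d else 0ℚ) xs) ≡ + count P xs / d
sum-indicator≡count/d P d [] = sym (0/n≡0 d)
sum-indicator≡count/d P d (x ∷ xs) with P x
... | true = trans (cong (+ 1 / d ℚ.+_) (sum-indicator≡count/d P d xs))
                   (i/d+j/d≡[i+j]/d (+ 1) (+ count P xs) d)
... | false = trans (+-identityˡ _) (sum-indicator≡count/d P d xs)

lemma19 : (m : ℕ) (b b' : Fin 2) →
    Ebb b b' (suc m) (replicate (suc m) ½)
      ≡ _/_ (+ fib (suc m Data.Nat.+ toℕ b Data.Nat.+ toℕ b')) (2 ^ suc m) {{m^n≢0 2 (suc m)}}
lemma19 m b b' = begin
  Ebb b b' n (replicate n ½)
    ≡⟨ cong (foldr ℚ._+_ 0ℚ) (map-cong term (allEdgeSets n)) ⟩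
  foldr ℚ._+_ 0ℚ (map (λ E → if covered l r E then 1/2ⁿ else 0ℚ) (allEdgeSets n))
    ≡⟨ sum-indicator≡count/d (covered l r) (2 ^ n) {{m^n≢0 2 n}} (allEdgeSets n) ⟩
  _/_ (+ coverCount l r n) (2 ^ n) {{m^n≢0 2 n}}
    ≡⟨ cong (λ k → _/_ (+ k) (2 ^ n) {{m^n≢0 2 n}}) (coverCount≡fib b b' n) ⟩
  _/_ (+ fib (n + toℕ b + toℕ b')) (2 ^ n) {{m^n≢0 2 n}} ∎
  where
  open ≡-Reasoning
  n = suc m
  l = isOne b
  r = isOne b'
  1/2ⁿ = _/_ (+ 1) (2 ^ n) {{m^n≢0 2 n}}
  term : ∀ E → (if coverOK b b' n E then weight (replicate n ½) E else 0ℚ)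
               ≡ (if covered l r E then 1/2ⁿ else 0ℚ)
  term E = cong₂ (λ c w → if c then w else 0ℚ) (coverOK≡covered b b' n E) (weight-replicate-½ n E)
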